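{- Let $G=(V,E)$ be a finite undirected graph with binary edge weights $w:E\to\{0,1\}$. Let $E_0$ be the set of edges of weight $0$, let $V_0$ be the set of vertices incident to some edge of $E_0$, and let $V_1=V\setminus V_0$. Let $k$ be the number of connected components of the graph $G_0=(V_0,E_0)$, and let $M$ be a maximum cardinality matching in the graph $G_1=(V_1,E_1(V_1))$, where $E_1(V_1)$ is the set of edges of $G$ with both endpoints in $V_1$. Then $|M|+k$ is a lower bound on the minimum weighted index of a forest cover of $G$.
   Context: A forest cover of $G$ is a forest $F$ in $G$ (acyclic subgraph with vertex set $V_F$ and edge set $E_F$; isolated vertices allowed) such that $V_F$ is a vertex cover of $G$. Its weighted index is $wi(F)=\sum_{e\in E_F}w_e+c_F$, where $c_F$ is the number of connected components of $F$. -}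

module Defs where

open import Data.Nat using (ℕ; zero; suc; _+_; _≤_)
open import Data.Fin using (Fin; zero; suc; toℕ; inject₁; fromℕ)
open import Data.Bool using (Bool; true; false; if_then_else_)
open import Data.Product using (Σ; _×_; _,_; proj₁; proj₂; ∃)
open import Data.Sum using (_⊎_)
open import Relation.Binary.PropositionalEquality using (_≡_; _≢_)
open import Relation.Nullary using (¬_)
open import Function.Definitions using (Injective; Surjective)
open import Function.Bundles using (_⇔_)

-- A finite undirected graph with binary edge weights:
-- vertices are Fin n, edges are indexed by Fin m, edge e has endpoints ends e
-- (unordered: the pair's orientation is irrelevant), weight w e ∈ {0,1}.
record WGraph : Set where
  field
    n    : ℕ
    m    : ℕ
    ends : Fin m → Fin n × Fin n
    w    : Fin m → Fin 2
open WGraph public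

Joins : (G : WGraph) → Fin (m G) → Fin (n G) → Fin (n G) → Set
Joins G e u v = (ends G e ≡ (u , v)) ⊎ (ends G e ≡ (v , u))

IncidentTo : (G : WGraph) → Fin (n G) → Fin (m G) → Set
IncidentTo G v e = (proj₁ (ends G e) ≡ v) ⊎ (proj₂ (ends G e) ≡ v)

Simple : WGraph → Set
Simple G = (∀ e → proj₁ (ends G e) ≢ proj₂ (ends G e))
         × (∀ e e' u v → Joins G e u v → Joins G e' u v → e ≡ e')

sumFin : ∀ {k} → (Fin k → ℕ) → ℕ
sumFin {zero}  f = 0
sumFin {suc k} f = f zero + sumFin (λ i → f (suc i))

card : ∀ {k} → (Fin k → Bool) → ℕ
card S = sumFin (λ i → if S i then 1 else 0)

data Reach (G : WGraph) (ES : Fin (m G) → Set) : Fin (n G) → Fin (n G) → Set where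
  here : ∀ {u} → Reach G ES u u
  step : ∀ {u v x} (e : Fin (m G)) → ES e → Joins G e u v → Reach G ES v x → Reach G ES u x

-- the subgraph (VS, ES) has exactly c connected components:
-- there is a surjective labelling of its vertices by Fin c whose fibres are
-- exactly the reachability classes.
NumComponents : (G : WGraph) (VS : Fin (n G) → Set) (ES : Fin (m G) → Set) → ℕ → Set
NumComponents G VS ES c =
  Σ ((v : Fin (n G)) → VS v → Fin c) λ lab →
    (∀ (i : Fin c) → Σ (Fin (n G)) λ v → Σ (VS v) λ pv → lab v pv ≡ i)
    × (∀ u v (pu : VS u) (pv : VS v) → (lab u pu ≡ lab v pv) ⇔ Reach G ES u v)

Cycle : (G : WGraph) (ES : Fin (m G) → Set) → Set
Cycle G ES =
  Σ ℕ λ l → Σ (Fin (suc l) → Fin (n G)) λ vs → Σ (Fin (suc l) → Fin (m G)) λ es →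
    Injective _≡_ _≡_ vs × Injective _≡_ _≡_ es × (∀ i → ES (es i))
    × (∀ (i : Fin l) → Joins G (es (inject₁ i)) (vs (inject₁ i)) (vs (suc i)))
    × Joins G (es (fromℕ l)) (vs (fromℕ l)) (vs zero)

IsForest : (G : WGraph) (VF : Fin (n G) → Bool) (EF : Fin (m G) → Bool) → Set
IsForest G VF EF =
  (∀ e v → EF e ≡ true → IncidentTo G v e → VF v ≡ true)
  × ¬ Cycle G (λ e → EF e ≡ true)

IsVertexCover : (G : WGraph) (VF : Fin (n G) → Bool) → Set
IsVertexCover G VF = ∀ e → Σ (Fin (n G)) λ v → IncidentTo G v e × VF v ≡ true

IsForestCover : (G : WGraph) (VF : Fin (n G) → Bool) (EF : Fin (m G) → Bool) → Set
IsForestCover G VF EF = IsForest G VF EF × IsVertexCover G VF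

weightOf : (G : WGraph) → (Fin (m G) → Bool) → ℕ
weightOf G EF = sumFin (λ e → if EF e then toℕ (w G e) else 0)

InE0 : (G : WGraph) → Fin (m G) → Set
InE0 G e = w G e ≡ zero

InV0 : (G : WGraph) → Fin (n G) → Set
InV0 G v = Σ (Fin (m G)) λ e → InE0 G e × IncidentTo G v e

InV1 : (G : WGraph) → Fin (n G) → Set
InV1 G v = ¬ InV0 G v

IsMatchingG1 : (G : WGraph) → (Fin (m G) → Bool) → Set
IsMatchingG1 G M =
  (∀ e v → M e ≡ true → IncidentTo G v e → InV1 G v)
  × (∀ e e' v → M e ≡ true → M e' ≡ true → IncidentTo G v e → IncidentTo G v e' → e ≡ e')

IsMaxMatchingG1 : (G : WGraph) → (Fin (m G) → Bool) → Set
IsMaxMatchingG1 G M = IsMatchingG1 G M × (∀ M' → IsMatchingG1 G M' → card M' ≤ card M)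

-- Pick one vertex of F on every edge of M and one vertex of F on an E₀-edge of
-- every component of G₀.  These |M| + k vertices are pairwise disconnected by
-- E₀-paths (a vertex of V₁ has no E₀-edge, and M is a matching), so they are
-- pairwise disconnected in F minus its weight-one edges.  Deleting an edge
-- raises the number of components by at most one, so that graph has at most
-- c_F + w(F) components, and |M| + k ≤ w(F) + c_F.
module Submission where

open import Defs
open import Level using (0ℓ)
open import Data.Nat using (ℕ; zero; suc; _+_; _≤_; s≤s; _≤?_)
open import Data.Nat.Properties
  using (≤-trans; +-suc; +-comm; +-identityʳ; +-monoʳ-≤; n≤1+n; module ≤-Reasoning)
import Data.Nat.Properties as ℕ
open import Data.Fin using (Fin; zero; suc; toℕ; splitAt; join; punchIn; _≟_)
open import Data.Fin.Properties using (¬Fin0; punchInᵢ≢i; punchIn-injective; injective⇒≤; join-splitAt)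
import Data.Fin.Properties as Fin
open import Data.Vec.Functional using (_++_)
open import Data.Bool using (Bool; true; false; _∧_; if_then_else_)
open import Data.Bool.Properties using (not-¬)
open import Data.Product using (Σ; ∃; _×_; _,_; proj₁; proj₂)
open import Data.Sum using (_⊎_; inj₁; inj₂; [_,_])
open import Data.Empty using (⊥-elim)
open import Function using (_∘_)
open import Function.Definitions using (Injective)
open import Function.Bundles using (Equivalence)
open import Relation.Nullary using (¬_; yes; no)
open import Relation.Nullary.Decidable using (decidable-stable; ¬¬-excluded-middle)
open import Relation.Unary using (Pred; _⊆_; _∪_; _∖_; ｛_｝)
open import Relation.Binary.PropositionalEquality
  using (_≡_; _≢_; refl; sym; trans; cong; cong₂; subst)

⟦_⟧ : ∀ {k} → (Fin k → Bool) → Pred (Fin k) 0ℓ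
⟦ P ⟧ i = P i ≡ true

sumFin-cong : ∀ {k} {f g : Fin k → ℕ} → (∀ i → f i ≡ g i) → sumFin f ≡ sumFin g
sumFin-cong {zero}  _   = refl
sumFin-cong {suc k} f≗g = cong₂ _+_ (f≗g zero) (sumFin-cong (f≗g ∘ suc))

remove : ∀ {k} → (Fin k → Bool) → Fin k → Fin k → Bool
remove P zero    zero    = false
remove P zero    (suc i) = P (suc i)
remove P (suc e) zero    = P zero
remove P (suc e) (suc i) = remove (P ∘ suc) e i

remove-≢ : ∀ {k} (P : Fin k → Bool) {e i} → e ≢ i → remove P e i ≡ P i
remove-≢ P {zero}  {zero}  e≢i = ⊥-elim (e≢i refl)
remove-≢ P {zero}  {suc i} _   = refl
remove-≢ P {suc e} {zero}  _   = refl
remove-≢ P {suc e} {suc i} e≢i = remove-≢ (P ∘ suc) (e≢i ∘ cong suc)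

card-remove : ∀ {k} (P : Fin k → Bool) {e} → P e ≡ true → card P ≡ suc (card (remove P e))
card-remove P {zero}  Pe rewrite Pe = refl
card-remove P {suc e} Pe =
  trans (cong ((if P zero then 1 else 0) +_) (card-remove (P ∘ suc) Pe)) (+-suc _ _)

card≡0⇒empty : ∀ {k} (P : Fin k → Bool) → card P ≡ 0 → ∀ i → ¬ P i ≡ true
card≡0⇒empty {suc k} P h i with P zero in eq
card≡0⇒empty {suc k} P () i      | true
card≡0⇒empty {suc k} P h zero    | false = not-¬ eq
card≡0⇒empty {suc k} P h (suc i) | false = card≡0⇒empty (P ∘ suc) h i

card≡suc⇒nonempty : ∀ {k} (P : Fin k → Bool) {c} → card P ≡ suc c → ∃ λ e → P e ≡ true
card≡suc⇒nonempty {suc k} P h with P zero in eq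
... | true  = zero , eq
... | false = let e , Pe = card≡suc⇒nonempty (P ∘ suc) h in suc e , Pe

enumerate : ∀ {k} (P : Fin k → Bool) →
            Σ (Fin (card P) → Fin k) λ f → Injective _≡_ _≡_ f × (∀ i → P (f i) ≡ true)
enumerate {zero}  P = (λ ()) , (λ {i} → ⊥-elim (¬Fin0 i)) , λ ()
enumerate {suc k} P with P zero in eq | enumerate (P ∘ suc)
... | false | f , f-inj , f∈P = suc ∘ f , f-inj ∘ Fin.suc-injective , f∈P
... | true  | f , f-inj , f∈P = g , g-inj , g∈P
  where
  g : Fin (suc (card (P ∘ suc))) → Fin (suc k)
  g zero    = zero
  g (suc i) = suc (f i)
  g-inj : Injective _≡_ _≡_ g
  g-inj {zero}  {zero}  _ = refl
  g-inj {suc i} {suc j} p = cong suc (f-inj (Fin.suc-injective p))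
  g∈P : ∀ i → P (g i) ≡ true
  g∈P zero    = eq
  g∈P (suc i) = f∈P i

splitAt-injective : ∀ m {n} {i j : Fin (m + n)} → splitAt m i ≡ splitAt m j → i ≡ j
splitAt-injective m {n} {i} {j} eq =
  trans (sym (join-splitAt m n i)) (trans (cong (join m n) eq) (join-splitAt m n j))

Separated : (G : WGraph) → Pred (Fin (m G)) 0ℓ → ∀ {N} → (Fin N → Fin (n G)) → Set
Separated G ES xs = ∀ i j → i ≢ j → ¬ Reach G ES (xs i) (xs j)

module _ {G : WGraph} where

  private
    V = Fin (n G)
    E = Fin (m G)

  Joins-sym : ∀ {e u v} → Joins G e u v → Joins G e v u
  Joins-sym (inj₁ p) = inj₂ p
  Joins-sym (inj₂ p) = inj₁ p

  Joins⇒IncidentTo : ∀ {e u v} → Joins G e u v → IncidentTo G u e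
  Joins⇒IncidentTo (inj₁ p) = inj₁ (cong proj₁ p)
  Joins⇒IncidentTo (inj₂ p) = inj₂ (cong proj₂ p)

  Reach-mono : ∀ {ES ES′ : Pred E 0ℓ} → ES ⊆ ES′ → ∀ {x y} → Reach G ES x y → Reach G ES′ x y
  Reach-mono ES⊆ES′ here           = here
  Reach-mono ES⊆ES′ (step e p j r) = step e (ES⊆ES′ p) j (Reach-mono ES⊆ES′ r)

  Reach-trans : ∀ {ES x y z} → Reach G ES x y → Reach G ES y z → Reach G ES x z
  Reach-trans here           r′ = r′
  Reach-trans (step e p j r) r′ = step e p j (Reach-trans r r′)

  Reach-sym : ∀ {ES x y} → Reach G ES x y → Reach G ES y x
  Reach-sym = reverseOnto here
    where
    reverseOnto : ∀ {ES v x u} → Reach G ES v u → Reach G ES v x → Reach G ES x u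
    reverseOnto acc here           = acc
    reverseOnto acc (step e p j r) = reverseOnto (step e p (Joins-sym j) acc) r

  IncidentTo⇒Reach : ∀ {ES : Pred E 0ℓ} {e x y} → ES e →
                     IncidentTo G x e → IncidentTo G y e → Reach G ES x y
  IncidentTo⇒Reach         p (inj₁ refl) (inj₁ refl) = here
  IncidentTo⇒Reach {e = e} p (inj₁ refl) (inj₂ refl) = step e p (inj₁ refl) here
  IncidentTo⇒Reach {e = e} p (inj₂ refl) (inj₁ refl) = step e p (inj₂ refl) here
  IncidentTo⇒Reach         p (inj₂ refl) (inj₂ refl) = here

  Reach-E0-from-V1 : ∀ {x y} → Reach G (InE0 G) x y → InV1 G x → x ≡ y
  Reach-E0-from-V1 here              _    = refl
  Reach-E0-from-V1 (step e e∈E₀ j _) x∈V₁ = ⊥-elim (x∈V₁ (e , e∈E₀ , Joins⇒IncidentTo j))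

  Reach-with-edge : ∀ {ES : Pred E 0ℓ} {e₀ x y} → Reach G (｛ e₀ ｝ ∪ ES) x y →
                    Reach G ES x y ⊎ Reach G ES x (proj₁ (ends G e₀)) ⊎ Reach G ES x (proj₂ (ends G e₀))
  Reach-with-edge here = inj₁ here
  Reach-with-edge (step e (inj₁ refl) (inj₁ refl) _) = inj₂ (inj₁ here)
  Reach-with-edge (step e (inj₁ refl) (inj₂ refl) _) = inj₂ (inj₂ here)
  Reach-with-edge (step e (inj₂ p) j r) with Reach-with-edge r
  ... | inj₁ r′        = inj₁ (step e p j r′)
  ... | inj₂ (inj₁ r′) = inj₂ (inj₁ (step e p j r′))
  ... | inj₂ (inj₂ r′) = inj₂ (inj₂ (step e p j r′))

  Separated-antimono : ∀ {ES ES′ : Pred E 0ℓ} → ES ⊆ ES′ →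
                       ∀ {N} {xs : Fin N → V} → Separated G ES′ xs → Separated G ES xs
  Separated-antimono ES⊆ES′ sep i j i≢j = sep i j i≢j ∘ Reach-mono ES⊆ES′

  Separated-∘ : ∀ {ES N N′} {xs : Fin N → V} {f : Fin N′ → Fin N} →
                Injective _≡_ _≡_ f → Separated G ES xs → Separated G ES (xs ∘ f)
  Separated-∘ f-inj sep i j i≢j = sep _ _ (i≢j ∘ f-inj)

  Separated-++ : ∀ {ES N N′} {xs : Fin N → V} {ys : Fin N′ → V} →
                 Separated G ES xs → Separated G ES ys → (∀ i j → ¬ Reach G ES (xs i) (ys j)) →
                 Separated G ES (xs ++ ys)
  Separated-++ {ES} {N} {xs = xs} {ys} sepx sepy apart i j i≢j =
    separate (splitAt N i) (splitAt N j) (i≢j ∘ splitAt-injective N)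
    where
    separate : ∀ a b → a ≢ b → ¬ Reach G ES ([ xs , ys ] a) ([ xs , ys ] b)
    separate (inj₁ a) (inj₁ b) a≢b = sepx a b (a≢b ∘ cong inj₁)
    separate (inj₁ a) (inj₂ b) _   = apart a b
    separate (inj₂ a) (inj₁ b) _   = apart b a ∘ Reach-sym
    separate (inj₂ a) (inj₂ b) a≢b = sepy a b (a≢b ∘ cong inj₂)

  -- Avoiding one endpoint of e₀ suffices: two vertices that both reach the
  -- other endpoint are already connected.
  Separated-with-edge : ∀ {ES : Pred E 0ℓ} {e₀ N} {xs : Fin N → V} → Separated G ES xs →
                        (∀ i → ¬ Reach G ES (xs i) (proj₁ (ends G e₀))) →
                        Separated G (｛ e₀ ｝ ∪ ES) xs
  Separated-with-edge sep avoid i j i≢j r with Reach-with-edge r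
  ... | inj₁ r′        = sep i j i≢j r′
  ... | inj₂ (inj₁ r′) = avoid i r′
  ... | inj₂ (inj₂ i⇝v) with Reach-with-edge (Reach-sym r)
  ...   | inj₁ r′        = sep i j i≢j (Reach-sym r′)
  ...   | inj₂ (inj₁ r′) = avoid j r′
  ...   | inj₂ (inj₂ j⇝v) = sep i j i≢j (Reach-trans i⇝v (Reach-sym j⇝v))

module _ {G : WGraph} {VS : Pred (Fin (n G)) 0ℓ} {ES : Pred (Fin (m G)) 0ℓ} {c : ℕ}
         (components : NumComponents G VS ES c) where

  private
    label = proj₁ components

    sameLabel⇒Reach : ∀ {u v} (u∈VS : VS u) (v∈VS : VS v) →
                      label u u∈VS ≡ label v v∈VS → Reach G ES u v
    sameLabel⇒Reach u∈VS v∈VS = Equivalence.to (proj₂ (proj₂ components) _ _ u∈VS v∈VS)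

  Separated⇒≤components : ∀ {N} {xs : Fin N → Fin (n G)} →
                          (∀ i → VS (xs i)) → Separated G ES xs → N ≤ c
  Separated⇒≤components xs∈VS sep = injective⇒≤ labels-injective
    where
    labels-injective : Injective _≡_ _≡_ (λ i → label _ (xs∈VS i))
    labels-injective {i} {j} eq =
      decidable-stable (i ≟ j) (λ i≢j → sep i j i≢j (sameLabel⇒Reach _ _ eq))

  -- Induction on card P, re-inserting one edge e₀ of P at a time.  Whether
  -- some xᵢ reaches the first endpoint of e₀ is not decidable, hence ¬ ¬.
  ¬¬Separated⇒≤components+card : ∀ d (P : Fin (m G) → Bool) → card P ≡ d →
    ∀ {N} {xs : Fin N → Fin (n G)} → (∀ i → VS (xs i)) → Separated G (ES ∖ ⟦ P ⟧) xs →
    ¬ ¬ (N ≤ c + d)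
  ¬¬Separated⇒≤components+card zero P card≡0 xs∈VS sep ¬goal =
    ¬goal (subst (_ ≤_) (sym (+-identityʳ c)) (Separated⇒≤components xs∈VS
      (Separated-antimono (λ e∈ES → e∈ES , card≡0⇒empty P card≡0 _) sep)))
  ¬¬Separated⇒≤components+card (suc d) P card≡1+d {N} {xs} xs∈VS sep ¬goal =
    ¬¬-excluded-middle {A = ∃ λ i → Reach G (ES ∖ ⟦ P ⟧) (xs i) u₀} λ where
      (yes (i₀ , xᵢ₀⇝u₀)) → dropReaching xs∈VS sep i₀ xᵢ₀⇝u₀ ¬goal
      (no none) →
        ¬¬Separated⇒≤components+card d P′ card-P′ xs∈VS
          (Separated-antimono P′-split (Separated-with-edge sep (λ i r → none (i , r))))
          (¬goal ∘ λ N≤ → ≤-trans N≤ (+-monoʳ-≤ c (n≤1+n d)))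
    where
    e₀ = proj₁ (card≡suc⇒nonempty P card≡1+d)
    u₀ = proj₁ (ends G e₀)
    P′ = remove P e₀

    card-P′ : card P′ ≡ d
    card-P′ = ℕ.suc-injective
      (trans (sym (card-remove P (proj₂ (card≡suc⇒nonempty P card≡1+d)))) card≡1+d)

    P′-split : ES ∖ ⟦ P′ ⟧ ⊆ ｛ e₀ ｝ ∪ (ES ∖ ⟦ P ⟧)
    P′-split {e} (e∈ES , e∉P′) with e₀ ≟ e
    ... | yes e₀≡e = inj₁ e₀≡e
    ... | no  e₀≢e = inj₂ (e∈ES , λ e∈P → e∉P′ (trans (remove-≢ P e₀≢e) e∈P))

    dropReaching : ∀ {N} {xs : Fin N → Fin (n G)} → (∀ i → VS (xs i)) → Separated G (ES ∖ ⟦ P ⟧) xs →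
               (i₀ : Fin N) → Reach G (ES ∖ ⟦ P ⟧) (xs i₀) u₀ → ¬ ¬ (N ≤ c + suc d)
    dropReaching {suc N} {xs} xs∈VS sep i₀ xᵢ₀⇝u₀ ¬goal =
      ¬¬Separated⇒≤components+card d P′ card-P′ (xs∈VS ∘ punchIn i₀)
        (Separated-antimono P′-split (Separated-with-edge
          (Separated-∘ (λ {j} {k} → punchIn-injective i₀ j k) sep) avoids-u₀))
        (¬goal ∘ λ N≤ → subst (suc N ≤_) (sym (+-suc c d)) (s≤s N≤))
      where
      avoids-u₀ : ∀ j → ¬ Reach G (ES ∖ ⟦ P ⟧) (xs (punchIn i₀ j)) u₀
      avoids-u₀ j xⱼ⇝u₀ = sep _ i₀ (punchInᵢ≢i i₀ j) (Reach-trans xⱼ⇝u₀ (Reach-sym xᵢ₀⇝u₀))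

  Separated⇒≤components+card : (P : Fin (m G) → Bool) →
    ∀ {N} {xs : Fin N → Fin (n G)} → (∀ i → VS (xs i)) → Separated G (ES ∖ ⟦ P ⟧) xs →
    N ≤ c + card P
  Separated⇒≤components+card P {N} xs∈VS sep =
    decidable-stable (N ≤? c + card P) (¬¬Separated⇒≤components+card _ P refl xs∈VS sep)

isOne : Fin 2 → Bool
isOne zero    = false
isOne (suc _) = true

heavyEdges : (G : WGraph) → (Fin (m G) → Bool) → Fin (m G) → Bool
heavyEdges G EF e = EF e ∧ isOne (w G e)

weightOf≡card-heavyEdges : ∀ G EF → weightOf G EF ≡ card (heavyEdges G EF)
weightOf≡card-heavyEdges G EF = sumFin-cong pointwise
  where
  pointwise : ∀ e → (if EF e then toℕ (w G e) else 0) ≡ (if heavyEdges G EF e then 1 else 0)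
  pointwise e with EF e | w G e
  ... | false | _        = refl
  ... | true  | zero     = refl
  ... | true  | suc zero = refl

lightEdges⊆E0 : ∀ G EF → ⟦ EF ⟧ ∖ ⟦ heavyEdges G EF ⟧ ⊆ InE0 G
lightEdges⊆E0 G EF {e} _ with EF e | w G e
lightEdges⊆E0 G EF (()    , _)       | false | _
lightEdges⊆E0 G EF (_     , _)       | true  | zero     = refl
lightEdges⊆E0 G EF (_     , e∉heavy) | true  | suc zero = ⊥-elim (e∉heavy refl)

module Representatives
  (G : WGraph) {k} (components₀ : NumComponents G (InV0 G) (InE0 G) k)
  (M : Fin (m G) → Bool) (matching : IsMatchingG1 G M)
  (VF : Fin (n G) → Bool) (cover : IsVertexCover G VF) where

  private
    label₀ = proj₁ components₀

    Reach⇒sameLabel : ∀ {u v} (u∈V₀ : InV0 G u) (v∈V₀ : InV0 G v) →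
                      Reach G (InE0 G) u v → label₀ u u∈V₀ ≡ label₀ v v∈V₀
    Reach⇒sameLabel u∈V₀ v∈V₀ = Equivalence.from (proj₂ (proj₂ components₀) _ _ u∈V₀ v∈V₀)

    matchedEdge : Fin (card M) → Fin (m G)
    matchedEdge = proj₁ (enumerate M)

    matchedEdge-injective : Injective _≡_ _≡_ matchedEdge
    matchedEdge-injective = proj₁ (proj₂ (enumerate M))

    matchedEdge∈M : ∀ i → M (matchedEdge i) ≡ true
    matchedEdge∈M = proj₂ (proj₂ (enumerate M))

  matchRep : Fin (card M) → Fin (n G)
  matchRep i = proj₁ (cover (matchedEdge i))

  matchRep-incident : ∀ i → IncidentTo G (matchRep i) (matchedEdge i)
  matchRep-incident i = proj₁ (proj₂ (cover (matchedEdge i)))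

  matchRep∈V₁ : ∀ i → InV1 G (matchRep i)
  matchRep∈V₁ i = proj₁ matching _ _ (matchedEdge∈M i) (matchRep-incident i)

  componentCover : (i : Fin k) → Σ (Fin (n G)) λ u →
                   VF u ≡ true × Σ (InV0 G u) λ u∈V₀ → label₀ u u∈V₀ ≡ i
  componentCover i with proj₁ (proj₂ components₀) i
  ... | v , (e , e∈E₀ , v∈e) , label-v≡i with cover e
  ...   | u , u∈e , u∈VF = u , u∈VF , (e , e∈E₀ , u∈e) ,
            trans (Reach⇒sameLabel _ _ (IncidentTo⇒Reach e∈E₀ u∈e v∈e)) label-v≡i

  componentRep : Fin k → Fin (n G)
  componentRep = proj₁ ∘ componentCover

  componentRep∈V₀ : ∀ i → InV0 G (componentRep i)
  componentRep∈V₀ i = proj₁ (proj₂ (proj₂ (componentCover i)))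

  componentRep-label : ∀ i → label₀ (componentRep i) (componentRep∈V₀ i) ≡ i
  componentRep-label i = proj₂ (proj₂ (proj₂ (componentCover i)))

  reps : Fin (card M + k) → Fin (n G)
  reps = matchRep ++ componentRep

  reps∈VF : ∀ i → VF (reps i) ≡ true
  reps∈VF i with splitAt (card M) i
  ... | inj₁ a = proj₂ (proj₂ (cover (matchedEdge a)))
  ... | inj₂ b = proj₁ (proj₂ (componentCover b))

  matchReps-separated : Separated G (InE0 G) matchRep
  matchReps-separated i j i≢j rᵢⱼ =
    i≢j (matchedEdge-injective (proj₂ matching _ _ _ (matchedEdge∈M i) (matchedEdge∈M j)
      (subst (λ x → IncidentTo G x (matchedEdge i)) (Reach-E0-from-V1 rᵢⱼ (matchRep∈V₁ i))
             (matchRep-incident i))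
      (matchRep-incident j)))

  componentReps-separated : Separated G (InE0 G) componentRep
  componentReps-separated i j i≢j rᵢⱼ =
    i≢j (trans (sym (componentRep-label i))
               (trans (Reach⇒sameLabel _ _ rᵢⱼ) (componentRep-label j)))

  matchRep-apart : ∀ i j → ¬ Reach G (InE0 G) (matchRep i) (componentRep j)
  matchRep-apart i j r = matchRep∈V₁ i
    (subst (InV0 G) (sym (Reach-E0-from-V1 r (matchRep∈V₁ i))) (componentRep∈V₀ j))

  reps-separated : Separated G (InE0 G) reps
  reps-separated = Separated-++ matchReps-separated componentReps-separated matchRep-apart

lemma2 : (G : WGraph) → Simple G
    → (k : ℕ) → NumComponents G (InV0 G) (InE0 G) k
    → (M : Fin (m G) → Bool) → IsMaxMatchingG1 G M
    → (VF : Fin (n G) → Bool) (EF : Fin (m G) → Bool) → IsForestCover G VF EF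
    → (cF : ℕ) → NumComponents G (λ v → VF v ≡ true) (λ e → EF e ≡ true) cF
    → card M + k ≤ weightOf G EF + cF
lemma2 G _ k components₀ M (matching , _) VF EF (_ , cover) cF components = begin
  card M + k                  ≤⟨ Separated⇒≤components+card components (heavyEdges G EF) reps∈VF
                                   (Separated-antimono (lightEdges⊆E0 G EF) reps-separated) ⟩
  cF + card (heavyEdges G EF) ≡⟨ +-comm cF _ ⟩
  card (heavyEdges G EF) + cF ≡⟨ cong (_+ cF) (weightOf≡card-heavyEdges G EF) ⟨
  weightOf G EF + cF          ∎
  where
  open ≤-Reasoning
  open Representatives G components₀ M matching VF cover
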